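{- Let $G$ be any finite simple graph on $n\geq 2$ vertices other than the path on $4$ vertices, and let $G^c$ be its complement. Then $\max\{i(G), i(G^c)\}\geq 1$.
   Context: For a graph $G=(V,E)$ and $X,Y\subseteq V$, $e_G(X,Y)$ denotes the set of edges of $G$ with one endpoint in $X$ and the other in $Y$. For $X\subseteq V$ write $\bar X=V\setminus X$ and $\partial_G(X)=e_G(X,\bar X)$. For a nonempty proper subset $X\subset V$, the isoperimetric number of $X$ is $i_G(X)=\frac{|\partial_G(X)|}{\min\{|X|,|\bar X|\}}$, and the isoperimetric number of $G$ is $i(G)=\min_{\emptyset\neq X\subsetneq V} i_G(X)$. The complement $G^c$ has vertex set $V$ and contains exactly the pairs of distinct vertices that are not edges of $G$. -}

module Defs where

open import Data.Nat using (ℕ; zero; suc; _<?_)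
open import Data.Nat as ℕ using (_⊓_)
open import Data.Integer using (+_)
open import Data.Bool using (Bool; true; false; not; _∧_; if_then_else_)
open import Data.Fin using (Fin; zero; suc)
open import Data.Fin.Properties using (_≟_)
open import Data.Fin.Subset using (Subset; _∈_; _∉_; ∣_∣)
open import Data.Fin.Subset.Properties using (_∈?_)
open import Data.Vec using (Vec; []; _∷_)
open import Data.List using (List; []; _∷_; map; _++_; length; filter; allFin; cartesianProductWith)
open import Data.Product using (_×_; _,_; Σ)
open import Relation.Nullary using (¬_; does)
open import Relation.Nullary.Decidable using (_×-dec_)
open import Relation.Binary.PropositionalEquality using (_≡_)
open import Function.Bundles using (_⤖_; Bijection)
open import Data.Rational using (ℚ; 0ℚ; _/_)
import Data.Rational as ℚ

record Graph (n : ℕ) : Set where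
  field
    adj    : Fin n → Fin n → Bool
    sym    : ∀ u v → adj u v ≡ adj v u
    irrefl : ∀ v → adj v v ≡ false
open Graph public

_ᶜ : ∀ {n} → Graph n → Graph n
_ᶜ {n} G = record { adj = a ; sym = s ; irrefl = ir }
  where
  neq : Fin n → Fin n → Bool
  neq u v = not (does (u ≟ v))
  a : Fin n → Fin n → Bool
  a u v = not (adj G u v) ∧ neq u v
  s : ∀ u v → a u v ≡ a v u
  s u v with adj G u v | adj G v u | sym G u v | u ≟ v | v ≟ u
  ... | _ | _ | Relation.Binary.PropositionalEquality.refl | Relation.Nullary.yes _ | Relation.Nullary.yes _ = Relation.Binary.PropositionalEquality.refl
  ... | _ | _ | Relation.Binary.PropositionalEquality.refl | Relation.Nullary.no _ | Relation.Nullary.no _ = Relation.Binary.PropositionalEquality.refl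
  ... | _ | _ | Relation.Binary.PropositionalEquality.refl | Relation.Nullary.yes p | Relation.Nullary.no q = Data.Empty.⊥-elim (q (Relation.Binary.PropositionalEquality.sym p))
    where import Data.Empty
  ... | _ | _ | Relation.Binary.PropositionalEquality.refl | Relation.Nullary.no q | Relation.Nullary.yes p = Data.Empty.⊥-elim (q (Relation.Binary.PropositionalEquality.sym p))
    where import Data.Empty
  ir : ∀ v → a v v ≡ false
  ir v with v ≟ v
  ... | Relation.Nullary.yes _ rewrite irrefl G v = Relation.Binary.PropositionalEquality.refl
  ... | Relation.Nullary.no ¬p = Data.Empty.⊥-elim (¬p Relation.Binary.PropositionalEquality.refl)
    where import Data.Empty

pairs : (n : ℕ) → List (Fin n × Fin n)
pairs n = cartesianProductWith _,_ (allFin n) (allFin n)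

-- |∂_G(X)| : number of edges uv with u ∈ X and v ∉ X (each edge counted once)
boundary : ∀ {n} → Graph n → Subset n → ℕ
boundary {n} G X = length (filter P? (pairs n))
  where
  P? : (p : Fin n × Fin n) → Relation.Nullary.Dec _
  P? (u , v) = (u ∈? X) ×-dec ((Relation.Nullary.¬? (v ∈? X)) ×-dec (Data.Bool._≟_ (adj G u v) true))
    where import Data.Bool

-- a / b as a rational (b = 0 never occurs for nonempty proper X)
divℚ : ℕ → ℕ → ℚ
divℚ a zero    = 0ℚ
divℚ a (suc b) = + a / suc b

compl : ∀ {n} → Subset n → Subset n
compl = Data.Fin.Subset.∁

isoSet : ∀ {n} → Graph n → Subset n → ℚ
isoSet G X = divℚ (boundary G X) (∣ X ∣ ⊓ ∣ compl X ∣)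

allSubsets : (n : ℕ) → List (Subset n)
allSubsets zero    = [] ∷ []
allSubsets (suc n) = map (true ∷_) (allSubsets n) ++ map (false ∷_) (allSubsets n)

properSubsets : (n : ℕ) → List (Subset n)
properSubsets n = filter (λ X → (0 <? ∣ X ∣) ×-dec (∣ X ∣ <? n)) (allSubsets n)

-- minimum of a list of rationals (default 0ℚ for the empty list, which
-- only occurs when n < 2)
minList : List ℚ → ℚ
minList []       = 0ℚ
minList (x ∷ xs) = go x xs
  where
  go : ℚ → List ℚ → ℚ
  go m []       = m
  go m (y ∷ ys) = go (m ℚ.⊓ y) ys

iso : ∀ {n} → Graph n → ℚ
iso {n} G = minList (map (isoSet G) (properSubsets n))

p4adj : Fin 4 → Fin 4 → Bool
p4adj zero (suc zero) = true
p4adj (suc zero) zero = true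
p4adj (suc zero) (suc (suc zero)) = true
p4adj (suc (suc zero)) (suc zero) = true
p4adj (suc (suc zero)) (suc (suc (suc zero))) = true
p4adj (suc (suc (suc zero))) (suc (suc zero)) = true
p4adj _ _ = false

IsP4 : ∀ {n} → Graph n → Set
IsP4 {n} G = Σ (Fin 4 ⤖ Fin n) λ f →
  ∀ i j → adj G (Bijection.to f i) (Bijection.to f j) ≡ p4adj i j

-- For cuts X of G and Y of Gᶜ let a, b, c, d be the sizes of X ∩ Y, X ∖ Y, Y ∖ X and X̄ ∩ Ȳ.
-- Two vertices taken from opposite cells (X ∩ Y and X̄ ∩ Ȳ, or X ∖ Y and Y ∖ X) are adjacent
-- either in G, and then the edge leaves X, or in Gᶜ, and then it leaves Y; hence
-- |∂_G X| + |∂_Gᶜ Y| ≥ a d + b c. If also i_G(X) < 1 and i_Gᶜ(Y) < 1, then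
-- a d + b c + 2 ≤ min(a + b, c + d) + min(a + c, b + d), which forces a = b = c = d = 1, so n = 4.
-- The graphs on four vertices other than P4 are checked by evaluation.

module Submission where

open import Defs hiding (sym)
open import Data.Nat using (ℕ; zero; suc; _+_; _*_; _⊓_; _≤_; _<_; z≤n; s≤s; _<?_)
open import Data.Nat.Properties
  using ( +-*-semiring; +-commutativeSemigroup; +-comm; *-comm; +-suc; ⊓-comm; ⊓-mono-≤; ≤-total
        ; ≤-trans; ≤-reflexive; +-mono-≤; +-monoˡ-≤; *-monoˡ-≤; +-cancelˡ-≤; *-identityʳ; *-distribˡ-+
        ; *-distribʳ-+; m+1+n≰m; m+n≡0⇒m≡0; m+n≡0⇒n≡0; n≤0⇒n≡0; m≤n⇒∃[o]m+o≡n; m≤n⇒m⊓n≡m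
        ; m+[n∸m]≡n; m<n⇒0<n∸m; module ≤-Reasoning)
  renaming (_≟_ to _≟ℕ_)
open import Data.Nat.Tactic.RingSolver using (solve-∀)
open import Data.Integer as ℤ using ()
import Data.Integer.Properties as ℤ
import Data.Rational
open import Data.Rational as ℚ using (ℚ; 1ℚ; _⊔_)
import Data.Rational.Properties as ℚ
import Data.Rational.Unnormalised as ℚᵘ
import Data.Rational.Unnormalised.Properties as ℚᵘ
open import Data.Bool using (Bool; true; false; not; _∧_)
import Data.Bool.Properties as Bool
open import Data.Fin using (Fin; zero; suc)
open import Data.Fin.Patterns using (0F; 1F; 2F; 3F)
open import Data.Fin.Properties using (_≟_; all?; any?)
open import Data.Fin.Subset using (Subset; inside; outside; ∣_∣; _∩_; ∁; ⁅_⁆)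
open import Data.Fin.Subset.Properties using (_∈?_; ∩-comm; ∣p∣≤n; ∣∁p∣≡n∸∣p∣; ∣⁅x⁆∣≡1)
open import Data.Vec using (Vec; []; _∷_; lookup)
open import Data.Vec.Properties using (lookup-map; lookup-zipWith)
open import Data.List using (List; []; _∷_; map; _++_; length; filter; tabulate; cartesianProductWith)
open import Data.List.Properties using (filter-++; length-++; map-tabulate; map-cong)
open import Data.List.Relation.Unary.All as All using ()
open import Data.List.Relation.Unary.Any as Any using (Any; here; there)
import Data.List.Relation.Unary.Any.Properties as Any
open import Data.List.Membership.Propositional using (_∈_; find)
open import Data.List.Membership.Propositional.Properties using (∈-map⁺; ∈-++⁺ˡ; ∈-++⁺ʳ; ∈-filter⁺; ∈-filter⁻)
open import Data.Product using (_×_; _,_; ∃; ∃-syntax; proj₂)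
open import Data.Sum using (_⊎_; inj₁; inj₂; [_,_]′)
open import Data.Empty using (⊥; ⊥-elim)
open import Function using (_∘_; id)
open import Function.Bundles using (mk⤖)
open import Function.Consequences.Propositional using (strictlySurjective⇒surjective)
open import Relation.Nullary using (Dec; does; yes; no; ¬_)
open import Relation.Nullary.Decidable using (True; toWitness; _×-dec_; _⊎-dec_; _→-dec_)
open import Relation.Unary using (Pred; Decidable)
open import Relation.Binary.PropositionalEquality
open import Algebra.Properties.Semiring.Sum +-*-semiring
  using (sum; sum-syntax; ∑-distrib-+; ∑-comm; *-distribˡ-sum; *-distribʳ-sum; sum-cong-≗)
open import Algebra.Properties.CommutativeSemigroup +-commutativeSemigroup using (interchange)

𝟙 : Bool → ℕ
𝟙 true  = 1
𝟙 false = 0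

sum-mono-≤ : ∀ {n} {f g : Fin n → ℕ} → (∀ i → f i ≤ g i) → sum f ≤ sum g
sum-mono-≤ {zero}  _   = z≤n
sum-mono-≤ {suc n} f≤g = +-mono-≤ (f≤g zero) (sum-mono-≤ (f≤g ∘ suc))

sum₂ : ∀ {m n} → (Fin m → Fin n → ℕ) → ℕ
sum₂ {m} {n} F = ∑[ i < m ] ∑[ j < n ] F i j

sum₂-mono-≤ : ∀ {m n} {F H : Fin m → Fin n → ℕ} → (∀ i j → F i j ≤ H i j) → sum₂ F ≤ sum₂ H
sum₂-mono-≤ F≤H = sum-mono-≤ (λ i → sum-mono-≤ (F≤H i))

sum₂-distrib-+ : ∀ {m n} (F H : Fin m → Fin n → ℕ) → sum₂ (λ i j → F i j + H i j) ≡ sum₂ F + sum₂ H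
sum₂-distrib-+ F H =
  trans (sum-cong-≗ (λ i → ∑-distrib-+ (F i) (H i))) (∑-distrib-+ (λ i → sum (F i)) (λ i → sum (H i)))

sum-*-sum : ∀ {m n} (f : Fin m → ℕ) (g : Fin n → ℕ) → sum f * sum g ≡ sum₂ (λ i j → f i * g j)
sum-*-sum f g = trans (*-distribʳ-sum (sum g) f) (sum-cong-≗ (λ i → *-distribˡ-sum (f i) g))

module _ {a p} {A : Set a} {P : Pred A p} (P? : Decidable P) where

  length-filter-tabulate : ∀ {n} (f : Fin n → A) →
    length (filter P? (tabulate f)) ≡ ∑[ i < n ] 𝟙 (does (P? (f i)))
  length-filter-tabulate {zero}  f = refl
  length-filter-tabulate {suc n} f with does (P? (f zero))
  ... | true  = cong suc (length-filter-tabulate (f ∘ suc))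
  ... | false = length-filter-tabulate (f ∘ suc)

  length-filter-++ : ∀ xs ys → length (filter P? (xs ++ ys)) ≡ length (filter P? xs) + length (filter P? ys)
  length-filter-++ xs ys = trans (cong length (filter-++ P? xs ys)) (length-++ (filter P? xs))

module _ {a b p} {A : Set a} {B : Set b} {P : Pred (A × B) p} (P? : Decidable P) where

  length-filter-cartesianProduct : ∀ {m n} (f : Fin m → A) (g : Fin n → B) →
    length (filter P? (cartesianProductWith _,_ (tabulate f) (tabulate g)))
      ≡ sum₂ (λ i j → 𝟙 (does (P? (f i , g j))))
  length-filter-cartesianProduct {zero}  f g = refl
  length-filter-cartesianProduct {suc m} {n} f g = begin
    length (filter P? (map (f zero ,_) (tabulate g) ++ rest))
      ≡⟨ length-filter-++ P? (map (f zero ,_) (tabulate g)) rest ⟩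
    length (filter P? (map (f zero ,_) (tabulate g))) + length (filter P? rest)
      ≡⟨ cong₂ _+_ first-row (length-filter-cartesianProduct (f ∘ suc) g) ⟩
    sum₂ (λ i j → 𝟙 (does (P? (f i , g j)))) ∎
    where
    open ≡-Reasoning
    rest : List (A × B)
    rest = cartesianProductWith _,_ (tabulate (f ∘ suc)) (tabulate g)
    first-row : length (filter P? (map (f zero ,_) (tabulate g))) ≡ ∑[ j < n ] 𝟙 (does (P? (f zero , g j)))
    first-row = trans (cong (length ∘ filter P?) (map-tabulate g (f zero ,_)))
                      (length-filter-tabulate P? ((f zero ,_) ∘ g))

χ : ∀ {n} → Subset n → Fin n → ℕ
χ X u = 𝟙 (lookup X u)

does-∈? : ∀ {n} (u : Fin n) (X : Subset n) → does (u ∈? X) ≡ lookup X u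
does-∈? zero    (inside  ∷ X) = refl
does-∈? zero    (outside ∷ X) = refl
does-∈? (suc u) (_ ∷ X)       = does-∈? u X

∣∣≡∑χ : ∀ {n} (X : Subset n) → ∣ X ∣ ≡ ∑[ u < n ] χ X u
∣∣≡∑χ []            = refl
∣∣≡∑χ (inside  ∷ X) = cong suc (∣∣≡∑χ X)
∣∣≡∑χ (outside ∷ X) = ∣∣≡∑χ X

∣p∣≡∣p∩q∣+∣p∩∁q∣ : ∀ {n} (p q : Subset n) → ∣ p ∣ ≡ ∣ p ∩ q ∣ + ∣ p ∩ ∁ q ∣
∣p∣≡∣p∩q∣+∣p∩∁q∣ []            []            = refl
∣p∣≡∣p∩q∣+∣p∩∁q∣ (inside  ∷ p) (inside  ∷ q) = cong suc (∣p∣≡∣p∩q∣+∣p∩∁q∣ p q)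
∣p∣≡∣p∩q∣+∣p∩∁q∣ (inside  ∷ p) (outside ∷ q) =
  trans (cong suc (∣p∣≡∣p∩q∣+∣p∩∁q∣ p q)) (sym (+-suc _ _))
∣p∣≡∣p∩q∣+∣p∩∁q∣ (outside ∷ p) (_       ∷ q) = ∣p∣≡∣p∩q∣+∣p∩∁q∣ p q

∣p∣+∣∁p∣≡n : ∀ {n} (p : Subset n) → ∣ p ∣ + ∣ ∁ p ∣ ≡ n
∣p∣+∣∁p∣≡n p = trans (cong (∣ p ∣ +_) (∣∁p∣≡n∸∣p∣ p)) (m+[n∸m]≡n (∣p∣≤n p))

∈-allSubsets : ∀ {n} (X : Subset n) → X ∈ allSubsets n
∈-allSubsets []                    = here refl
∈-allSubsets {suc n} (inside  ∷ X) = ∈-++⁺ˡ (∈-map⁺ (inside ∷_) (∈-allSubsets X))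
∈-allSubsets {suc n} (outside ∷ X) =
  ∈-++⁺ʳ (map (inside ∷_) (allSubsets n)) (∈-map⁺ (outside ∷_) (∈-allSubsets X))

private
  proper? : ∀ n (X : Subset n) → Dec (0 < ∣ X ∣ × ∣ X ∣ < n)
  proper? n X = (0 <? ∣ X ∣) ×-dec (∣ X ∣ <? n)

∈-properSubsets⁺ : ∀ {n} {X : Subset n} → 0 < ∣ X ∣ → ∣ X ∣ < n → X ∈ properSubsets n
∈-properSubsets⁺ {n} {X} 0<∣X∣ ∣X∣<n = ∈-filter⁺ (proper? n) (∈-allSubsets X) (0<∣X∣ , ∣X∣<n)

∈-properSubsets⁻ : ∀ {n} {X : Subset n} → X ∈ properSubsets n → 0 < ∣ X ∣ × ∣ X ∣ < n
∈-properSubsets⁻ {n} X∈ = proj₂ (∈-filter⁻ (proper? n) {xs = allSubsets n} X∈)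

⁅u⁆∈properSubsets : ∀ {k} (u : Fin (suc (suc k))) → ⁅ u ⁆ ∈ properSubsets (suc (suc k))
⁅u⁆∈properSubsets {k} u =
  ∈-properSubsets⁺ (subst (0 <_) 1≡∣⁅u⁆∣ (s≤s z≤n)) (subst (_< 2 + k) 1≡∣⁅u⁆∣ (s≤s (s≤s z≤n)))
  where
  1≡∣⁅u⁆∣ : 1 ≡ ∣ ⁅ u ⁆ ∣
  1≡∣⁅u⁆∣ = sym (∣⁅x⁆∣≡1 u)

boundary≡sum₂ : ∀ {n} (G : Graph n) (X : Subset n) →
  boundary G X ≡ sum₂ (λ u v → χ X u * χ (∁ X) v * 𝟙 (adj G u v))
boundary≡sum₂ {n} G X = trans (length-filter-cartesianProduct _ {n} {n} id id)
  (sum-cong-≗ λ u → sum-cong-≗ λ v → begin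
    𝟙 (does (u ∈? X) ∧ not (does (v ∈? X)) ∧ does (adj G u v Bool.≟ true))
      ≡⟨ cong₂ (λ p q → 𝟙 (p ∧ not q ∧ does (adj G u v Bool.≟ true))) (does-∈? u X) (does-∈? v X) ⟩
    𝟙 (lookup X u ∧ not (lookup X v) ∧ does (adj G u v Bool.≟ true))
      ≡⟨ 𝟙-∧ (lookup X u) (lookup X v) (adj G u v) ⟩
    χ X u * 𝟙 (not (lookup X v)) * 𝟙 (adj G u v)
      ≡⟨ cong (λ p → χ X u * 𝟙 p * 𝟙 (adj G u v)) (lookup-map v not X) ⟨
    χ X u * χ (∁ X) v * 𝟙 (adj G u v) ∎)
  where
  open ≡-Reasoning
  𝟙-∧ : ∀ p q r → 𝟙 (p ∧ not q ∧ does (r Bool.≟ true)) ≡ 𝟙 p * 𝟙 (not q) * 𝟙 r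
  𝟙-∧ false _     _     = refl
  𝟙-∧ true  true  _     = refl
  𝟙-∧ true  false false = refl
  𝟙-∧ true  false true  = refl

module _ {n} (G H : Graph n) (G≗H : ∀ u v → adj G u v ≡ adj H u v) where

  boundary-cong : ∀ X → boundary G X ≡ boundary H X
  boundary-cong X = begin
    boundary G X                                      ≡⟨ boundary≡sum₂ G X ⟩
    sum₂ (λ u v → χ X u * χ (∁ X) v * 𝟙 (adj G u v))
      ≡⟨ sum-cong-≗ (λ u → sum-cong-≗ λ v → cong (λ b → χ X u * χ (∁ X) v * 𝟙 b) (G≗H u v)) ⟩
    sum₂ (λ u v → χ X u * χ (∁ X) v * 𝟙 (adj H u v))  ≡⟨ boundary≡sum₂ H X ⟨
    boundary H X                                      ∎
    where open ≡-Reasoning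

  iso-cong : iso G ≡ iso H
  iso-cong = cong minList
    (map-cong (λ X → cong (λ b → divℚ b (∣ X ∣ ⊓ ∣ compl X ∣)) (boundary-cong X)) (properSubsets n))

  ᶜ-cong : ∀ u v → adj (G ᶜ) u v ≡ adj (H ᶜ) u v
  ᶜ-cong u v = cong (λ b → not b ∧ not (does (u ≟ v))) (G≗H u v)

  IsP4-cong : IsP4 H → IsP4 G
  IsP4-cong (f , f-iso) = f , λ i j → trans (G≗H _ _) (f-iso i j)

-- Pairs of vertices in opposite cells of two cuts

adj+adjᶜ≡1 : ∀ {n} (G : Graph n) {u v} → ¬ u ≡ v → 𝟙 (adj G u v) + 𝟙 (adj (G ᶜ) u v) ≡ 1
adj+adjᶜ≡1 G {u} {v} u≢v with u ≟ v | adj G u v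
... | yes u≡v | _     = ⊥-elim (u≢v u≡v)
... | no _    | true  = refl
... | no _    | false = refl

opposite : ∀ {n} → Subset n → Subset n → Fin n → Fin n → ℕ
opposite X Y u v = χ (X ∩ Y) u * χ (∁ X ∩ ∁ Y) v + χ (X ∩ ∁ Y) u * χ (∁ X ∩ Y) v

oppositeᵇ : Bool → Bool → Bool → Bool → ℕ
oppositeᵇ p q r s = 𝟙 (p ∧ q) * 𝟙 (not r ∧ not s) + 𝟙 (p ∧ not q) * 𝟙 (not r ∧ s)

opposite≡oppositeᵇ : ∀ {n} (X Y : Subset n) u v →
  opposite X Y u v ≡ oppositeᵇ (lookup X u) (lookup Y u) (lookup X v) (lookup Y v)
opposite≡oppositeᵇ X Y u v
  rewrite lookup-zipWith _∧_ u X Y | lookup-zipWith _∧_ u X (∁ Y) | lookup-map u not Y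
        | lookup-zipWith _∧_ v (∁ X) (∁ Y) | lookup-zipWith _∧_ v (∁ X) Y
        | lookup-map v not X | lookup-map v not Y = refl

oppositeᵇ-diagonal : ∀ p q → oppositeᵇ p q p q ≡ 0
oppositeᵇ-diagonal false _     = refl
oppositeᵇ-diagonal true  true  = refl
oppositeᵇ-diagonal true  false = refl

oppositeᵇ≤ : ∀ p q r s → oppositeᵇ p q r s ≤ 𝟙 p * 𝟙 (not r)
oppositeᵇ≤ false _     _     _     = z≤n
oppositeᵇ≤ true  true  true  _     = z≤n
oppositeᵇ≤ true  false true  _     = z≤n
oppositeᵇ≤ true  true  false true  = z≤n
oppositeᵇ≤ true  true  false false = s≤s z≤n
oppositeᵇ≤ true  false false true  = s≤s z≤n
oppositeᵇ≤ true  false false false = z≤n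

opposite-diagonal : ∀ {n} (X Y : Subset n) u → opposite X Y u u ≡ 0
opposite-diagonal X Y u = trans (opposite≡oppositeᵇ X Y u u) (oppositeᵇ-diagonal (lookup X u) (lookup Y u))

opposite≤cut : ∀ {n} (X Y : Subset n) u v → opposite X Y u v ≤ χ X u * χ (∁ X) v
opposite≤cut X Y u v rewrite opposite≡oppositeᵇ X Y u v | lookup-map v not X =
  oppositeᵇ≤ (lookup X u) (lookup Y u) (lookup X v) (lookup Y v)

opposite-transpose : ∀ {n} (X Y : Subset n) u v →
  opposite Y X u v ≡ χ (X ∩ Y) u * χ (∁ X ∩ ∁ Y) v + χ (X ∩ ∁ Y) v * χ (∁ X ∩ Y) u
opposite-transpose X Y u v = cong₂ _+_
  (cong₂ (λ A B → χ A u * χ B v) (∩-comm Y X) (∩-comm (∁ Y) (∁ X)))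
  (trans (cong₂ (λ A B → χ A u * χ B v) (∩-comm Y (∁ X)) (∩-comm (∁ Y) X))
         (*-comm (χ (∁ X ∩ Y) u) (χ (X ∩ ∁ Y) v)))

sum₂-opposite-transpose : ∀ {n} (X Y : Subset n) (h : Fin n → Fin n → ℕ) → (∀ u v → h u v ≡ h v u) →
  sum₂ (λ u v → opposite X Y u v * h u v) ≡ sum₂ (λ u v → opposite Y X u v * h u v)
sum₂-opposite-transpose {n} X Y h h-sym = begin
  sum₂ (λ u v → opposite X Y u v * h u v)
    ≡⟨ sum-cong-≗ (λ u → sum-cong-≗ λ v → *-distribʳ-+ (h u v) (AD u v) (BC u v)) ⟩
  sum₂ (λ u v → AD u v * h u v + BC u v * h u v)
    ≡⟨ sum₂-distrib-+ (λ u v → AD u v * h u v) (λ u v → BC u v * h u v) ⟩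
  sum₂ (λ u v → AD u v * h u v) + sum₂ (λ u v → BC u v * h u v)
    ≡⟨ cong (sum₂ (λ u v → AD u v * h u v) +_) (trans (∑-comm (λ u v → BC u v * h u v))
         (sum-cong-≗ λ u → sum-cong-≗ λ v → cong (BC v u *_) (h-sym v u))) ⟩
  sum₂ (λ u v → AD u v * h u v) + sum₂ (λ u v → BC v u * h u v)
    ≡⟨ sum₂-distrib-+ (λ u v → AD u v * h u v) (λ u v → BC v u * h u v) ⟨
  sum₂ (λ u v → AD u v * h u v + BC v u * h u v)
    ≡⟨ sum-cong-≗ (λ u → sum-cong-≗ λ v → trans (cong (_* h u v) (opposite-transpose X Y u v))
         (*-distribʳ-+ (h u v) (AD u v) (BC v u))) ⟨
  sum₂ (λ u v → opposite Y X u v * h u v) ∎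
  where
  open ≡-Reasoning
  AD BC : Fin n → Fin n → ℕ
  AD u v = χ (X ∩ Y) u * χ (∁ X ∩ ∁ Y) v
  BC u v = χ (X ∩ ∁ Y) u * χ (∁ X ∩ Y) v

opposite-split : ∀ {n} (G : Graph n) (X Y : Subset n) u v →
  opposite X Y u v ≤ opposite X Y u v * 𝟙 (adj G u v) + opposite X Y u v * 𝟙 (adj (G ᶜ) u v)
opposite-split G X Y u v = by-cases (u ≟ v)
  where
  open ≡-Reasoning
  k : ℕ
  k = opposite X Y u v
  by-cases : Dec (u ≡ v) → k ≤ k * 𝟙 (adj G u v) + k * 𝟙 (adj (G ᶜ) u v)
  by-cases (yes refl) rewrite opposite-diagonal X Y u = z≤n
  by-cases (no u≢v) = ≤-reflexive (begin
    k                                                  ≡⟨ *-identityʳ k ⟨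
    k * 1                                              ≡⟨ cong (k *_) (adj+adjᶜ≡1 G u≢v) ⟨
    k * (𝟙 (adj G u v) + 𝟙 (adj (G ᶜ) u v))            ≡⟨ *-distribˡ-+ k _ _ ⟩
    k * 𝟙 (adj G u v) + k * 𝟙 (adj (G ᶜ) u v)          ∎)

crossing-bound : ∀ {n} (G : Graph n) (X Y : Subset n) →
  ∣ X ∩ Y ∣ * ∣ ∁ X ∩ ∁ Y ∣ + ∣ X ∩ ∁ Y ∣ * ∣ ∁ X ∩ Y ∣ ≤ boundary G X + boundary (G ᶜ) Y
crossing-bound {n} G X Y = begin
  ∣ X ∩ Y ∣ * ∣ ∁ X ∩ ∁ Y ∣ + ∣ X ∩ ∁ Y ∣ * ∣ ∁ X ∩ Y ∣
    ≡⟨ cong₂ _+_ (size-product (X ∩ Y) (∁ X ∩ ∁ Y)) (size-product (X ∩ ∁ Y) (∁ X ∩ Y)) ⟩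
  sum₂ (λ u v → χ (X ∩ Y) u * χ (∁ X ∩ ∁ Y) v) + sum₂ (λ u v → χ (X ∩ ∁ Y) u * χ (∁ X ∩ Y) v)
    ≡⟨ sum₂-distrib-+ (λ u v → χ (X ∩ Y) u * χ (∁ X ∩ ∁ Y) v)
                      (λ u v → χ (X ∩ ∁ Y) u * χ (∁ X ∩ Y) v) ⟨
  sum₂ (opposite X Y)
    ≤⟨ sum₂-mono-≤ (opposite-split G X Y) ⟩
  sum₂ (λ u v → opposite X Y u v * g u v + opposite X Y u v * h u v)
    ≡⟨ sum₂-distrib-+ (λ u v → opposite X Y u v * g u v) (λ u v → opposite X Y u v * h u v) ⟩
  sum₂ (λ u v → opposite X Y u v * g u v) + sum₂ (λ u v → opposite X Y u v * h u v)
    ≡⟨ cong (sum₂ (λ u v → opposite X Y u v * g u v) +_)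
            (sum₂-opposite-transpose X Y h (λ u v → cong 𝟙 (Graph.sym (G ᶜ) u v))) ⟩
  sum₂ (λ u v → opposite X Y u v * g u v) + sum₂ (λ u v → opposite Y X u v * h u v)
    ≤⟨ +-mono-≤ (sum₂-mono-≤ λ u v → *-monoˡ-≤ (g u v) (opposite≤cut X Y u v))
                (sum₂-mono-≤ λ u v → *-monoˡ-≤ (h u v) (opposite≤cut Y X u v)) ⟩
  sum₂ (λ u v → χ X u * χ (∁ X) v * g u v) + sum₂ (λ u v → χ Y u * χ (∁ Y) v * h u v)
    ≡⟨ cong₂ _+_ (boundary≡sum₂ G X) (boundary≡sum₂ (G ᶜ) Y) ⟨
  boundary G X + boundary (G ᶜ) Y ∎
  where
  open ≤-Reasoning
  g h : Fin n → Fin n → ℕ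
  g u v = 𝟙 (adj G u v)
  h u v = 𝟙 (adj (G ᶜ) u v)
  size-product : ∀ A B → ∣ A ∣ * ∣ B ∣ ≡ sum₂ (λ u v → χ A u * χ B v)
  size-product A B = trans (cong₂ _*_ (∣∣≡∑χ A) (∣∣≡∑χ B)) (sum-*-sum (χ A) (χ B))

-- a, b, c, d are the sizes of the cells X ∩ Y, X ∖ Y, Y ∖ X, X̄ ∩ Ȳ of two cuts X, Y,
-- and x, y are the sizes of their boundaries.
record SparseCells (a b c d x y : ℕ) : Set where
  constructor sparseCells
  field
    x<    : x < (a + b) ⊓ (c + d)
    y<    : y < (a + c) ⊓ (b + d)
    ≤x+y  : a * d + b * c ≤ x + y

SparseCells-swapˣ : ∀ {a b c d x y} → SparseCells a b c d x y → SparseCells c d a b x y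
SparseCells-swapˣ {a} {b} {c} {d} {x} {y} (sparseCells x< y< ≤x+y) = sparseCells
  (subst (x <_) (⊓-comm (a + b) (c + d)) x<)
  (subst (y <_) (cong₂ _⊓_ (+-comm a c) (+-comm b d)) y<)
  (subst (_≤ x + y) (trans (+-comm (a * d) (b * c)) (cong₂ _+_ (*-comm b c) (*-comm a d))) ≤x+y)

SparseCells-swapʸ : ∀ {a b c d x y} → SparseCells a b c d x y → SparseCells b a d c x y
SparseCells-swapʸ {a} {b} {c} {d} {x} {y} (sparseCells x< y< ≤x+y) = sparseCells
  (subst (x <_) (cong₂ _⊓_ (+-comm a b) (+-comm c d)) x<)
  (subst (y <_) (⊓-comm (a + c) (b + d)) y<)
  (subst (_≤ x + y) (+-comm (a * d) (b * c)) ≤x+y)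

SparseCells-transpose : ∀ {a b c d x y} → SparseCells a b c d x y → SparseCells a c b d y x
SparseCells-transpose {a} {b} {c} {d} {x} {y} (sparseCells x< y< ≤x+y) =
  sparseCells y< x< (subst₂ _≤_ (cong (a * d +_) (*-comm b c)) (+-comm x y) ≤x+y)

private
  exceeds : ∀ {m n} k → m ≡ n + suc k → m ≤ n → ⊥
  exceeds {n = n} k refl = m+1+n≰m n

-- This is the case c = b + e, d = a + e + f; the two sides of the hypothesis differ by
-- (a - 1)² + (b - 1)² + (a + b - 1) e + a f.
tight-cells⇒total≡4 : ∀ a b e f → 1 ≤ a + b →
  a * (a + e + f) + b * (b + e) + 2 ≤ (a + b) + (a + (b + e)) → (a + b) + ((b + e) + (a + e + f)) ≡ 4
tight-cells⇒total≡4 0 0 e f () _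
tight-cells⇒total≡4 0 (suc b) e f _ h = ⊥-elim (exceeds (b * b + b * e) (lemma b e f) h)
  where
  lemma : ∀ b e f → 0 * (0 + e + f) + suc b * (suc b + e) + 2
                    ≡ (0 + suc b) + (0 + (suc b + e)) + suc (b * b + b * e)
  lemma = solve-∀
tight-cells⇒total≡4 1 0 e f _ h = ⊥-elim (exceeds f (lemma e f) h)
  where
  lemma : ∀ e f → 1 * (1 + e + f) + 0 * (0 + e) + 2 ≡ (1 + 0) + (1 + (0 + e)) + suc f
  lemma = solve-∀
tight-cells⇒total≡4 1 1 e f _ h with +-cancelˡ-≤ (4 + e) (e + f) 0 (subst₂ _≤_ (lhs e f) (rhs e) h)
  where
  lhs : ∀ e f → 1 * (1 + e + f) + 1 * (1 + e) + 2 ≡ (4 + e) + (e + f)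
  lhs = solve-∀
  rhs : ∀ e → (1 + 1) + (1 + (1 + e)) ≡ (4 + e) + 0
  rhs = solve-∀
... | e+f≤0 with m+n≡0⇒m≡0 e (n≤0⇒n≡0 e+f≤0) | m+n≡0⇒n≡0 e (n≤0⇒n≡0 e+f≤0)
...   | refl | refl = refl
tight-cells⇒total≡4 1 (suc (suc b)) e f _ h =
  ⊥-elim (exceeds (b * b + b * e + 2 * b + 2 * e + f) (lemma b e f) h)
  where
  lemma : ∀ b e f → 1 * (1 + e + f) + (2 + b) * (2 + b + e) + 2
                    ≡ (1 + (2 + b)) + (1 + (2 + b + e)) + suc (b * b + b * e + 2 * b + 2 * e + f)
  lemma = solve-∀
tight-cells⇒total≡4 (suc (suc a)) 0 e f _ h =
  ⊥-elim (exceeds (1 + a * a + a * e + a * f + 2 * a + e + 2 * f) (lemma a e f) h)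
  where
  lemma : ∀ a e f → (2 + a) * (2 + a + e + f) + 0 * (0 + e) + 2
                    ≡ (2 + a + 0) + (2 + a + (0 + e)) + suc (1 + a * a + a * e + a * f + 2 * a + e + 2 * f)
  lemma = solve-∀
tight-cells⇒total≡4 (suc (suc a)) (suc b) e f _ h =
  ⊥-elim (exceeds (a * a + a * e + a * f + 2 * a + 2 * e + 2 * f + b * b + b * e) (lemma a b e f) h)
  where
  lemma : ∀ a b e f → (2 + a) * (2 + a + e + f) + suc b * (suc b + e) + 2
                      ≡ (2 + a + suc b) + (2 + a + (suc b + e))
                        + suc (a * a + a * e + a * f + 2 * a + 2 * e + 2 * f + b * b + b * e)
  lemma = solve-∀

-- By the symmetries of SparseCells it suffices to treat a + b ≤ c + d, a + c ≤ b + d and b ≤ c.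
private
  total≡4-corner-b≤c : ∀ {a b c d x y} → a + b ≤ c + d → a + c ≤ b + d → b ≤ c →
    SparseCells a b c d x y → (a + b) + (c + d) ≡ 4
  total≡4-corner-b≤c {a} {b} {c} {d} {x} {y} ab≤cd ac≤bd b≤c (sparseCells x< y< ≤x+y)
    with m≤n⇒∃[o]m+o≡n b≤c
  ... | e , refl with m≤n⇒∃[o]m+o≡n (+-cancelˡ-≤ b (a + e) d (subst (_≤ b + d) (+-comm-middle a b e) ac≤bd))
    where
    +-comm-middle : ∀ a b e → a + (b + e) ≡ b + (a + e)
    +-comm-middle = solve-∀
  ... | f , refl = tight-cells⇒total≡4 a b e f (≤-trans (s≤s z≤n) x<a+b) (begin
    a * d + b * c + 2  ≤⟨ +-monoˡ-≤ 2 ≤x+y ⟩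
    x + y + 2          ≡⟨ +-suc-suc x y ⟩
    suc x + suc y      ≤⟨ +-mono-≤ x<a+b y<a+c ⟩
    (a + b) + (a + c)  ∎)
    where
    open ≤-Reasoning
    x<a+b : x < a + b
    x<a+b = subst (x <_) (m≤n⇒m⊓n≡m ab≤cd) x<
    y<a+c : y < a + c
    y<a+c = subst (y <_) (m≤n⇒m⊓n≡m ac≤bd) y<
    +-suc-suc : ∀ x y → x + y + 2 ≡ suc x + suc y
    +-suc-suc = solve-∀

  total≡4-corner : ∀ {a b c d x y} → a + b ≤ c + d → a + c ≤ b + d →
    SparseCells a b c d x y → (a + b) + (c + d) ≡ 4
  total≡4-corner {a} {b} {c} {d} ab≤cd ac≤bd s with ≤-total b c
  ... | inj₁ b≤c = total≡4-corner-b≤c ab≤cd ac≤bd b≤c s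
  ... | inj₂ c≤b = trans (interchange a b c d) (total≡4-corner-b≤c ac≤bd ab≤cd c≤b (SparseCells-transpose s))

  total≡4-row : ∀ {a b c d x y} → a + b ≤ c + d → SparseCells a b c d x y → (a + b) + (c + d) ≡ 4
  total≡4-row {a} {b} {c} {d} ab≤cd s with ≤-total (a + c) (b + d)
  ... | inj₁ ac≤bd = total≡4-corner ab≤cd ac≤bd s
  ... | inj₂ bd≤ac = trans (cong₂ _+_ (+-comm a b) (+-comm c d))
    (total≡4-corner (subst₂ _≤_ (+-comm a b) (+-comm c d) ab≤cd) bd≤ac (SparseCells-swapʸ s))

SparseCells⇒total≡4 : ∀ {a b c d x y} → SparseCells a b c d x y → (a + b) + (c + d) ≡ 4
SparseCells⇒total≡4 {a} {b} {c} {d} s with ≤-total (a + b) (c + d)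
... | inj₁ ab≤cd = total≡4-row ab≤cd s
... | inj₂ cd≤ab = trans (+-comm (a + b) (c + d)) (total≡4-row cd≤ab (SparseCells-swapˣ s))

-- Cuts with isoperimetric ratio below 1

SparseCut : ∀ {n} → Graph n → Subset n → Set
SparseCut G X = boundary G X < ∣ X ∣ ⊓ ∣ ∁ X ∣

sparse-cuts⇒n≡4 : ∀ {n} (G : Graph n) (X Y : Subset n) → SparseCut G X → SparseCut (G ᶜ) Y → n ≡ 4
sparse-cuts⇒n≡4 {n} G X Y X-sparse Y-sparse = begin
  n                                                      ≡⟨ ∣p∣+∣∁p∣≡n X ⟨
  ∣ X ∣ + ∣ ∁ X ∣                                        ≡⟨ cong₂ _+_ (split X Y) (split (∁ X) Y) ⟩
  (∣ X ∩ Y ∣ + ∣ X ∩ ∁ Y ∣) + (∣ ∁ X ∩ Y ∣ + ∣ ∁ X ∩ ∁ Y ∣) ≡⟨ SparseCells⇒total≡4 cells-sparse ⟩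
  4                                                      ∎
  where
  open ≡-Reasoning
  split : ∀ Z W → ∣ Z ∣ ≡ ∣ Z ∩ W ∣ + ∣ Z ∩ ∁ W ∣
  split = ∣p∣≡∣p∩q∣+∣p∩∁q∣
  split-by-X : ∀ Z → ∣ Z ∣ ≡ ∣ X ∩ Z ∣ + ∣ ∁ X ∩ Z ∣
  split-by-X Z = trans (split Z X) (cong₂ _+_ (cong ∣_∣ (∩-comm Z X)) (cong ∣_∣ (∩-comm Z (∁ X))))
  cells-sparse : SparseCells (∣ X ∩ Y ∣) (∣ X ∩ ∁ Y ∣) (∣ ∁ X ∩ Y ∣) (∣ ∁ X ∩ ∁ Y ∣)
                             (boundary G X) (boundary (G ᶜ) Y)
  cells-sparse = sparseCells
    (subst (boundary G X <_) (cong₂ _⊓_ (split X Y) (split (∁ X) Y)) X-sparse)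
    (subst (boundary (G ᶜ) Y <_) (cong₂ _⊓_ (split-by-X Y) (split-by-X (∁ Y))) Y-sparse)
    (crossing-bound G X Y)

minList-<⇒Any : ∀ {q} x xs → minList (x ∷ xs) ℚ.< q → Any (ℚ._< q) (x ∷ xs)
minList-<⇒Any x []       x<q = here x<q
minList-<⇒Any {q} x (y ∷ ys) min<q with minList-<⇒Any (x ℚ.⊓ y) ys min<q
... | there p = there (there p)
... | here x⊓y<q with ℚ.⊓-sel x y
...   | inj₁ x⊓y≡x = here (subst (ℚ._< q) x⊓y≡x x⊓y<q)
...   | inj₂ x⊓y≡y = there (here (subst (ℚ._< q) x⊓y≡y x⊓y<q))

-- The membership proof only excludes the empty list, whose minList is 0ℚ.
minList-map-<⇒∃ : ∀ {A : Set} (f : A → ℚ) {q x} {xs : List A} → x ∈ xs →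
  minList (map f xs) ℚ.< q → ∃[ y ] y ∈ xs × f y ℚ.< q
minList-map-<⇒∃ f {xs = y ∷ ys} _ min<q = find (Any.map⁻ (minList-<⇒Any (f y) (map f ys) min<q))

divℚ<1⇒< : ∀ a b → 0 < b → divℚ a b ℚ.< 1ℚ → a < b
divℚ<1⇒< a (suc b) _ a/b<1
  with ℚᵘ.<-respˡ-≃ (ℚ.toℚᵘ-fromℚᵘ (ℚᵘ.mkℚᵘ (ℤ.+ a) b)) (ℚ.toℚᵘ-mono-< a/b<1)
... | ℚᵘ.*<* a*1<1*b =
  ℤ.drop‿+<+ (subst₂ ℤ._<_ (ℤ.*-identityʳ (ℤ.+ a)) (ℤ.*-identityˡ (ℤ.+ suc b)) a*1<1*b)

iso<1⇒SparseCut : ∀ {n} (G : Graph n) → 2 ≤ n → iso G ℚ.< 1ℚ → ∃ (SparseCut G)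
iso<1⇒SparseCut {suc zero} G (s≤s ())
iso<1⇒SparseCut {suc (suc k)} G _ iso<1 with minList-map-<⇒∃ (isoSet G) (⁅u⁆∈properSubsets zero) iso<1
... | X , X∈ , isoSet<1 with ∈-properSubsets⁻ X∈
... | 0<∣X∣ , ∣X∣<n =
  X , divℚ<1⇒< (boundary G X) (∣ X ∣ ⊓ ∣ ∁ X ∣) (⊓-mono-≤ 0<∣X∣ 0<∣∁X∣) isoSet<1
  where
  0<∣∁X∣ : 0 < ∣ ∁ X ∣
  0<∣∁X∣ = subst (0 <_) (sym (∣∁p∣≡n∸∣p∣ X)) (m<n⇒0<n∸m ∣X∣<n)

-- Graphs on four vertices

∀-subset : ∀ {n p} {P : Subset n → Set p} (P? : Decidable P) →
  True (All.all? P? (allSubsets n)) → ∀ X → P X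
∀-subset P? check X = All.lookup (toWitness check) (∈-allSubsets X)

adjacency₄ : Subset 6 → Fin 4 → Fin 4 → Bool
adjacency₄ (e₀₁ ∷ e₀₂ ∷ e₀₃ ∷ e₁₂ ∷ e₁₃ ∷ e₂₃ ∷ []) u v = lookup (lookup rows u) v
  where
  rows : Vec (Vec Bool 4) 4
  rows = (false ∷ e₀₁ ∷ e₀₂ ∷ e₀₃ ∷ [])
       ∷ (e₀₁ ∷ false ∷ e₁₂ ∷ e₁₃ ∷ [])
       ∷ (e₀₂ ∷ e₁₂ ∷ false ∷ e₂₃ ∷ [])
       ∷ (e₀₃ ∷ e₁₃ ∷ e₂₃ ∷ false ∷ [])
       ∷ []

graph₄ : Subset 6 → Graph 4
graph₄ E = record
  { adj    = adjacency₄ E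
  ; sym    = ∀-subset (λ F → all? λ u → all? λ v → adjacency₄ F u v Bool.≟ adjacency₄ F v u) _ E
  ; irrefl = ∀-subset (λ F → all? λ v → adjacency₄ F v v Bool.≟ false) _ E
  }

edgeSet₄ : Graph 4 → Subset 6
edgeSet₄ G = adj G 0F 1F ∷ adj G 0F 2F ∷ adj G 0F 3F ∷ adj G 1F 2F ∷ adj G 1F 3F ∷ adj G 2F 3F ∷ []

adj≡adjacency₄-edgeSet₄ : ∀ (G : Graph 4) u v → adj G u v ≡ adjacency₄ (edgeSet₄ G) u v
adj≡adjacency₄-edgeSet₄ G 0F 0F = irrefl G 0F
adj≡adjacency₄-edgeSet₄ G 0F 1F = refl
adj≡adjacency₄-edgeSet₄ G 0F 2F = refl
adj≡adjacency₄-edgeSet₄ G 0F 3F = refl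
adj≡adjacency₄-edgeSet₄ G 1F 0F = Graph.sym G 1F 0F
adj≡adjacency₄-edgeSet₄ G 1F 1F = irrefl G 1F
adj≡adjacency₄-edgeSet₄ G 1F 2F = refl
adj≡adjacency₄-edgeSet₄ G 1F 3F = refl
adj≡adjacency₄-edgeSet₄ G 2F 0F = Graph.sym G 2F 0F
adj≡adjacency₄-edgeSet₄ G 2F 1F = Graph.sym G 2F 1F
adj≡adjacency₄-edgeSet₄ G 2F 2F = irrefl G 2F
adj≡adjacency₄-edgeSet₄ G 2F 3F = refl
adj≡adjacency₄-edgeSet₄ G 3F 0F = Graph.sym G 3F 0F
adj≡adjacency₄-edgeSet₄ G 3F 1F = Graph.sym G 3F 1F
adj≡adjacency₄-edgeSet₄ G 3F 2F = Graph.sym G 3F 2F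
adj≡adjacency₄-edgeSet₄ G 3F 3F = irrefl G 3F

P4Labelling : Graph 4 → (Fin 4 → Fin 4) → Set
P4Labelling G σ =
  (∀ i j → σ i ≡ σ j → i ≡ j) × (∀ v → ∃ λ i → σ i ≡ v) × (∀ i j → adj G (σ i) (σ j) ≡ p4adj i j)

P4Labelling? : ∀ G σ → Dec (P4Labelling G σ)
P4Labelling? G σ = (all? λ i → all? λ j → σ i ≟ σ j →-dec i ≟ j)
              ×-dec (all? λ v → any? λ i → σ i ≟ v)
              ×-dec (all? λ i → all? λ j → adj G (σ i) (σ j) Bool.≟ p4adj i j)

P4Labelling⇒IsP4 : ∀ {G σ} → P4Labelling G σ → IsP4 G
P4Labelling⇒IsP4 (injective , surjective , path) =
  mk⤖ ((λ {i} {j} → injective i j) , strictlySurjective⇒surjective surjective) , path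

-- One vertex ordering for each labelled copy of P4, i.e. each Hamiltonian path up to reversal.
pathOrderings : List (Vec (Fin 4) 4)
pathOrderings =
    (0F ∷ 1F ∷ 2F ∷ 3F ∷ []) ∷ (0F ∷ 1F ∷ 3F ∷ 2F ∷ []) ∷ (0F ∷ 2F ∷ 1F ∷ 3F ∷ [])
  ∷ (0F ∷ 2F ∷ 3F ∷ 1F ∷ []) ∷ (0F ∷ 3F ∷ 1F ∷ 2F ∷ []) ∷ (0F ∷ 3F ∷ 2F ∷ 1F ∷ [])
  ∷ (1F ∷ 0F ∷ 2F ∷ 3F ∷ []) ∷ (1F ∷ 0F ∷ 3F ∷ 2F ∷ []) ∷ (1F ∷ 2F ∷ 0F ∷ 3F ∷ [])
  ∷ (1F ∷ 3F ∷ 0F ∷ 2F ∷ []) ∷ (2F ∷ 0F ∷ 1F ∷ 3F ∷ []) ∷ (2F ∷ 1F ∷ 0F ∷ 3F ∷ [])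
  ∷ []

four-vertex-check : ∀ E →
  1ℚ ℚ.≤ iso (graph₄ E) ⊔ iso (graph₄ E ᶜ) ⊎ Any (P4Labelling (graph₄ E) ∘ lookup) pathOrderings
four-vertex-check =
  ∀-subset (λ E → 1ℚ ℚ.≤? _ ⊎-dec Any.any? (P4Labelling? (graph₄ E) ∘ lookup) pathOrderings) _

four-vertices : (G : Graph 4) → ¬ IsP4 G → 1ℚ ℚ.≤ iso G ⊔ iso (G ᶜ)
four-vertices G ¬p4 = [ transfer , contradiction-P4 ]′ (four-vertex-check (edgeSet₄ G))
  where
  M : Graph 4
  M = graph₄ (edgeSet₄ G)
  G≗M : ∀ u v → adj G u v ≡ adj M u v
  G≗M = adj≡adjacency₄-edgeSet₄ G
  transfer : 1ℚ ℚ.≤ iso M ⊔ iso (M ᶜ) → 1ℚ ℚ.≤ iso G ⊔ iso (G ᶜ)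
  transfer = subst₂ (λ p q → 1ℚ ℚ.≤ p ⊔ q)
    (sym (iso-cong G M G≗M)) (sym (iso-cong (G ᶜ) (M ᶜ) (ᶜ-cong G M G≗M)))
  contradiction-P4 : Any (P4Labelling M ∘ lookup) pathOrderings → 1ℚ ℚ.≤ iso G ⊔ iso (G ᶜ)
  contradiction-P4 labelled =
    ⊥-elim (¬p4 (IsP4-cong G M G≗M (P4Labelling⇒IsP4 {M} (proj₂ (Any.satisfied labelled)))))

theorem2p2 : (n : ℕ) → 2 ≤ n → (G : Graph n) → ¬ IsP4 G →
    Data.Rational._≤_ 1ℚ (iso G ⊔ iso (G ᶜ))
theorem2p2 n 2≤n G ¬p4 with n ≟ℕ 4
... | yes refl = four-vertices G ¬p4
... | no n≢4 with 1ℚ ℚ.≤? iso G | 1ℚ ℚ.≤? iso (G ᶜ)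
...   | yes 1≤iG | _          = ℚ.≤-trans 1≤iG (ℚ.p≤p⊔q (iso G) (iso (G ᶜ)))
...   | no _     | yes 1≤iGᶜ  = ℚ.≤-trans 1≤iGᶜ (ℚ.p≤q⊔p (iso G) (iso (G ᶜ)))
...   | no 1≰iG  | no 1≰iGᶜ
  with iso<1⇒SparseCut G 2≤n (ℚ.≰⇒> 1≰iG) | iso<1⇒SparseCut (G ᶜ) 2≤n (ℚ.≰⇒> 1≰iGᶜ)
... | X , X-sparse | Y , Y-sparse = ⊥-elim (n≢4 (sparse-cuts⇒n≡4 G X Y X-sparse Y-sparse))
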